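{- Let $\underline n=(n_0,n_1,\dots,n_k)$ be a composition of $n$ (nonnegative integers with $n_0+\dots+n_k=n$). Then \[ \sum_{f\in\mathbb N_0^{(r,n)}(\underline n)}p^{\mathrm{inv}(f)}a^{\mathrm{col}(f)}=\frac{[\hat n]_{x,p}!}{[\hat n_0]_{x,p}!\,[n_1]_p!\cdots[n_k]_p!},\qquad x=a[r-1]_{ap}. \]
   Context: Notation: $(y;p)_0=1$, $(y;p)_m=(1-y)(1-yp)\cdots(1-yp^{m-1})$; $[m]_p=1+p+\dots+p^{m-1}$, $[m]_p!=[m]_p\cdots[1]_p$, $[0]_p!=1$; $[\hat m]_{x,p}!=(-xp;p)_m[m]_p!$; $[r-1]_{ap}=1+ap+\dots+(ap)^{r-2}$. $G(r,n)$ is the set of $r$-colored permutations $\gamma=(c_1,\dots,c_n;\sigma)$, $c_i\in\{0,\dots,r-1\}$, $\sigma\in S_n$, written $\gamma=[\gamma(1),\dots,\gamma(n)]=[\sigma(1)^{c_1},\dots,\sigma(n)^{c_n}]$. Colored integers $x^c$ ($x^0=x$) are totally ordered by: uncolored integers in natural order; every $x^c$ with $c\ge1$ is smaller than every uncolored integer; for $c,d\ge1$, $x^c<y^d$ iff $x>y$, or $x=y$ and $c>d$. $\mathrm{col}(\gamma)=\sum_ic_i$; $\mathrm{inv}(\gamma)=\#\{(i,j):1\le i<j\le n,\ \gamma(i)>\gamma(j)\}$; $\ell_G(\gamma)=\mathrm{inv}(\gamma)+\sum_{i:\,c_i\ne0}(\sigma(i)+c_i-1)$. $\mathbb N_0^{(r,n)}$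 is the set of $n$-tuples $f=(f_1^{c_1},\dots,f_n^{c_n})$ with $f_i\in\mathbb N$, $c_i\in\{0,\dots,r-1\}$, $c_i=0$ whenever $f_i=0$. For such $f$ and $\nu\in\mathbb N$ let $A_\nu=\{i^{c_i}:f_i=\nu\}$; arranging each nonempty $A_\nu$ increasingly and juxtaposing blocks in order of increasing $\nu$ gives the window notation of $\pi(f)\in G(r,n)$. Set $\mathrm{inv}(f)=\ell_G(\pi(f))$ and $\mathrm{col}(f)=\mathrm{col}(\pi(f))$. $\mathbb N_0^{(r,n)}(\underline n)=\{f\in\mathbb N_0^{(r,n)}:\#\{i:f_i=j\}=n_j \text{ for } j=0,\dots,k\}$. -}

module Defs where

open import Level using (Level)
open import Data.Bool using (Bool; true; false; _∧_; _∨_; if_then_else_)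
open import Data.Nat using (ℕ; zero; suc; _+_; _∸_; _≡ᵇ_; _<ᵇ_)
open import Data.Product using (_×_; _,_; proj₁; proj₂)
open import Data.List using (List; []; _∷_; [_]; map; concatMap; filterᵇ; upTo; length; foldr)
open import Data.Vec using (Vec; []; _∷_; lookup; toList)
open import Data.Fin using (Fin; toℕ)
open import Data.List using (allFin)
open import Algebra.Bundles using (CommutativeSemiring)

-- Colored integers x^c are represented as pairs (x , c) : ℕ × ℕ.
-- Colored permutations are represented by their window notation
-- [σ(1)^{c_1}, …, σ(n)^{c_n}] as a list of such pairs.

_<ᶜ_ : ℕ × ℕ → ℕ × ℕ → Bool
(x , zero)  <ᶜ (y , zero)  = x <ᵇ y
(x , suc _) <ᶜ (y , zero)  = true
(x , zero)  <ᶜ (y , suc _) = false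
(x , suc c) <ᶜ (y , suc d) = (y <ᵇ x) ∨ ((x ≡ᵇ y) ∧ (d <ᵇ c))

invW : List (ℕ × ℕ) → ℕ
invW []       = 0
invW (x ∷ xs) = length (filterᵇ (λ y → y <ᶜ x) xs) + invW xs

colW : List (ℕ × ℕ) → ℕ
colW []            = 0
colW ((_ , c) ∷ w) = c + colW w

colPart : List (ℕ × ℕ) → ℕ
colPart []                = 0
colPart ((s , zero) ∷ w)  = colPart w
colPart ((s , suc c) ∷ w) = s + c + colPart w

ℓG : List (ℕ × ℕ) → ℕ
ℓG w = invW w + colPart w

insertᶜ : ℕ × ℕ → List (ℕ × ℕ) → List (ℕ × ℕ)
insertᶜ x []       = [ x ]
insertᶜ x (y ∷ ys) = if y <ᶜ x then y ∷ insertᶜ x ys else x ∷ y ∷ ys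

sortᶜ : List (ℕ × ℕ) → List (ℕ × ℕ)
sortᶜ = foldr insertᶜ []

-- Elements f = (f_1^{c_1}, …, f_n^{c_n}) are vectors of pairs (f_i , c_i).

indexedFrom : ∀ {n} → ℕ → Vec (ℕ × ℕ) n → List (ℕ × (ℕ × ℕ))
indexedFrom s []       = []
indexedFrom s (e ∷ es) = (s , e) ∷ indexedFrom (suc s) es

block : ∀ {n} → Vec (ℕ × ℕ) n → ℕ → List (ℕ × ℕ)
block f ν = sortᶜ (map (λ t → proj₁ t , proj₂ (proj₂ t))
                       (filterᵇ (λ t → proj₁ (proj₂ t) ≡ᵇ ν) (indexedFrom 1 f)))

-- π(f): juxtapose the blocks A_0, A_1, …, A_{b-1}  (b a bound exceeding all f_i)
πf : ∀ {n} → ℕ → Vec (ℕ × ℕ) n → List (ℕ × ℕ)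
πf b f = concatMap (block f) (upTo b)

vecs : ∀ {A : Set} (n : ℕ) → List A → List (Vec A n)
vecs zero    xs = [ [] ]
vecs (suc n) xs = concatMap (λ x → map (x ∷_) (vecs n xs)) xs

allᵇ : ∀ {A : Set} → (A → Bool) → List A → Bool
allᵇ p []       = true
allᵇ p (x ∷ xs) = p x ∧ allᵇ p xs

cnt : ∀ {n} → ℕ → Vec (ℕ × ℕ) n → ℕ
cnt j f = length (filterᵇ (λ e → proj₁ e ≡ᵇ j) (toList f))

colorOK : ℕ × ℕ → Bool
colorOK (zero , zero)  = true
colorOK (zero , suc _) = false
colorOK (suc _ , _)    = true

inSet : ∀ {n k} → Vec ℕ (suc k) → Vec (ℕ × ℕ) n → Bool
inSet {k = k} comp f =
  allᵇ colorOK (toList f) ∧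
  allᵇ (λ j → cnt (toℕ j) f ≡ᵇ lookup comp j) (allFin (suc k))

-- all pairs (v , c) with v ≤ k, c < r  (values f_i ≤ k are forced by the counts)
entries : ℕ → ℕ → List (ℕ × ℕ)
entries k r = concatMap (λ v → map (v ,_) (upTo r)) (upTo (suc k))

NSet : (r n k : ℕ) → Vec ℕ (suc k) → List (Vec (ℕ × ℕ) n)
NSet r n k comp = filterᵇ (inSet comp) (vecs n (entries k r))

invF : ∀ {n} → ℕ → Vec (ℕ × ℕ) n → ℕ
invF k f = ℓG (πf (suc k) f)

colF : ∀ {n} → ℕ → Vec (ℕ × ℕ) n → ℕ
colF k f = colW (πf (suc k) f)

sumℕ : List ℕ → ℕ
sumℕ = foldr _+_ 0

module _ {c ℓ : Level} (R : CommutativeSemiring c ℓ) where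
  open CommutativeSemiring R renaming (_+_ to _⊕_; _*_ to _⊛_)

  pow : Carrier → ℕ → Carrier
  pow y zero    = 1#
  pow y (suc m) = y ⊛ pow y m

  sumR : List Carrier → Carrier
  sumR = foldr _⊕_ 0#

  prodR : List Carrier → Carrier
  prodR = foldr _⊛_ 1#

  qint : Carrier → ℕ → Carrier
  qint p m = sumR (map (pow p) (upTo m))

  qfact : Carrier → ℕ → Carrier
  qfact p zero    = 1#
  qfact p (suc m) = qint p (suc m) ⊛ qfact p m

  negPoch : Carrier → Carrier → ℕ → Carrier
  negPoch x p m = prodR (map (λ i → 1# ⊕ (x ⊛ pow p (suc i))) (upTo m))

  hatfact : Carrier → Carrier → ℕ → Carrier
  hatfact x p m = negPoch x p m ⊛ qfact p m

  xpar : ℕ → Carrier → Carrier → Carrier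
  xpar r a p = a ⊛ qint (a ⊛ p) (r ∸ 1)

  genSum : (r n k : ℕ) → Vec ℕ (suc k) → Carrier → Carrier → Carrier
  genSum r n k comp p a =
    sumR (map (λ f → pow p (invF k f) ⊛ pow a (colF k f)) (NSet r n k comp))

  prodFactsTail : ∀ {m} → Carrier → Vec ℕ m → Carrier
  prodFactsTail p []       = 1#
  prodFactsTail p (m ∷ ms) = qfact p m ⊛ prodFactsTail p ms

-- Induction on n, splitting f as f′ followed by a last entry (v , c) of index n. Among coloured
-- integers of index ≤ n, (n , 0) is the largest and (n , c) with c ≥ 1 the smallest, so in π(f)
-- the new index sits at the end of the block A_v when c = 0 and at its start otherwise. Hence inv
-- grows by n_{v+1} + ⋯ + n_k when c = 0 and by n_0 + ⋯ + n_{v-1} + n + c - 1 when c ≥ 1, while col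
-- grows by c; colours c ≥ 1 require v ≥ 1. Summing over c, the generating function satisfies
--   G(n̲) = Σ_v [n_v > 0] G(n̲ - e_v) (p^{n_{v+1}+⋯+n_k} + [v ≥ 1] x p^{n_0+⋯+n_{v-1}+n}),
-- and the claim reduces to the q-identity
--   p^{n_1+⋯+n_k} (1 + x p^{n_0}) [n_0] + Σ_{v≥1} (p^{n_{v+1}+⋯+n_k} + x p^{n_0+⋯+n_{v-1}+n}) [n_v]
--     = (1 + x p^n) [n],
-- a consequence of [a + b]_p = [a]_p + p^a [b]_p.

module Submission where

open import Defs
open import Level using (Level)
open import Data.Nat using (ℕ; suc; _≤_)
open import Data.Vec using (Vec; _∷_; toList)
open import Relation.Binary.PropositionalEquality using (_≡_)
open import Algebra.Bundles using (CommutativeSemiring)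

module Combinatorics where

  open import Data.Bool using (Bool; true; false; _∧_; if_then_else_)
  open import Data.Bool.Properties
    using (T-≡; ∧-assoc; ∧-identityʳ; ∧-conicalˡ; ∧-conicalʳ; ∧-commutativeMonoid)
  open import Data.Nat using (ℕ; zero; suc; pred; _+_; _∸_; _≤_; _<_; s≤s; _≡ᵇ_; _<ᵇ_)
  open import Data.Nat.Properties
    using (_≟_; ≡⇒≡ᵇ; ≡ᵇ⇒≡; <⇒<ᵇ; +-suc; +-assoc; +-comm; +-identityʳ; m≤m+n; <⇒≤; <⇒≢; >⇒≢;
           <-trans; ≤-refl; ≤-pred; m≤o∸n⇒m+n≤o; m+n≡0⇒m≡0; m+n≡0⇒n≡0; +-commutativeSemigroup)
  open import Data.Nat.Tactic.RingSolver using (solve-∀)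
  open import Data.Product using (_×_; _,_; proj₁; proj₂)
  open import Data.List
    using (List; []; _∷_; [_]; _++_; length; map; concat; concatMap; filterᵇ; upTo; applyUpTo; allFin)
  open import Data.List.Properties
    using (map-applyUpTo; map-cong-local; map-++; length-++; ++-assoc; ++-identityʳ; filter-++; concatMap-++)
  open import Data.List.Relation.Unary.All using (All; []; _∷_; universal)
  open import Data.List.Relation.Unary.All.Properties
    using (++⁺; concat⁺; map⁺; filter⁺; applyUpTo⁺₁; applyUpTo⁺₂; tabulate⁺; tabulate⁻)
  open import Data.List.Relation.Binary.Permutation.Propositional using (_↭_; prep; swap; ↭-refl; ↭-trans; ↭-sym)
  open import Data.List.Relation.Binary.Permutation.Propositional.Properties using (All-resp-↭; ↭-length)
  open import Data.Vec using (Vec; []; _∷_; _∷ʳ_; toList; lookup)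
  open import Data.Vec.Properties using (toList-∷ʳ)
  open import Data.Fin as Fin using (toℕ; fromℕ<)
  open import Data.Fin.Properties using (toℕ<n; toℕ-fromℕ<)
  open import Data.Empty using (⊥-elim)
  open import Relation.Binary.PropositionalEquality as ≡ using (_≡_; _≢_; refl; subst; cong; cong₂; sym; trans)
  open import Relation.Nullary.Decidable using (T?; yes; no)
  open import Function using (_∘_; id)
  open import Function.Bundles using (Equivalence)
  open import Algebra.Bundles using (CommutativeMonoid)
  open import Algebra.Properties.CommutativeSemigroup +-commutativeSemigroup using (x∙yz≈y∙xz; xy∙z≈xz∙y)
  open import Algebra.Properties.CommutativeSemigroup (CommutativeMonoid.commutativeSemigroup ∧-commutativeMonoid)
    using () renaming (interchange to ∧-interchange)

  applyUpTo-+ : ∀ {A : Set} (f : ℕ → A) m n →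
                applyUpTo f (m + n) ≡ applyUpTo f m ++ applyUpTo (λ i → f (m + i)) n
  applyUpTo-+ f zero    n = refl
  applyUpTo-+ f (suc m) n = cong (f 0 ∷_) (applyUpTo-+ (f ∘ suc) m n)

  applyUpTo-split : ∀ {A : Set} (f : ℕ → A) {v b} → v < b →
    applyUpTo f b ≡ applyUpTo f v ++ f v ∷ applyUpTo (λ i → f (suc v + i)) (b ∸ suc v)
  applyUpTo-split f {zero}  {suc b} _       = refl
  applyUpTo-split f {suc v} {suc b} (s≤s p) = cong (f 0 ∷_) (applyUpTo-split (f ∘ suc) p)

  map-applyUpTo-shift : ∀ {A : Set} (g : ℕ → A) (f : ℕ → ℕ) n →
                        map g (applyUpTo (suc ∘ f) n) ≡ map (g ∘ suc) (applyUpTo f n)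
  map-applyUpTo-shift g f n = trans (map-applyUpTo (suc ∘ f) g n) (sym (map-applyUpTo f (g ∘ suc) n))

  concatMap-cong-local : ∀ {A B : Set} {g h : A → List B} {xs} →
                         All (λ x → g x ≡ h x) xs → concatMap g xs ≡ concatMap h xs
  concatMap-cong-local eqs = cong concat (map-cong-local eqs)

  length-concatMap : ∀ {A B : Set} (g : A → List B) xs → length (concatMap g xs) ≡ sumℕ (map (length ∘ g) xs)
  length-concatMap g []       = refl
  length-concatMap g (x ∷ xs) = trans (length-++ (g x)) (cong (length (g x) +_) (length-concatMap g xs))

  module _ {A : Set} (Q : A → Bool) where

    filterᵇ-all : ∀ {R : A → Set} → (∀ y → R y → Q y ≡ true) → ∀ {l} → All R l → filterᵇ Q l ≡ l
    filterᵇ-all h []         = refl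
    filterᵇ-all h (_∷_ {y} r rs) rewrite h y r = cong (y ∷_) (filterᵇ-all h rs)

    filterᵇ-none : ∀ {R : A → Set} → (∀ y → R y → Q y ≡ false) → ∀ {l} → All R l → filterᵇ Q l ≡ []
    filterᵇ-none h []         = refl
    filterᵇ-none h (_∷_ {y} r rs) rewrite h y r = filterᵇ-none h rs

    length-filterᵇ-reject : ∀ as bs z → Q z ≡ false →
                            length (filterᵇ Q (as ++ z ∷ bs)) ≡ length (filterᵇ Q (as ++ bs))
    length-filterᵇ-reject []       bs z e rewrite e = refl
    length-filterᵇ-reject (a ∷ as) bs z e with Q a
    ... | true  = cong suc (length-filterᵇ-reject as bs z e)
    ... | false = length-filterᵇ-reject as bs z e

    length-filterᵇ-accept : ∀ as bs z → Q z ≡ true →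
                            length (filterᵇ Q (as ++ z ∷ bs)) ≡ suc (length (filterᵇ Q (as ++ bs)))
    length-filterᵇ-accept []       bs z e rewrite e = refl
    length-filterᵇ-accept (a ∷ as) bs z e with Q a
    ... | true  = cong suc (length-filterᵇ-accept as bs z e)
    ... | false = length-filterᵇ-accept as bs z e

    allᵇ⇒All : ∀ xs → allᵇ Q xs ≡ true → All (λ x → Q x ≡ true) xs
    allᵇ⇒All []       _   = []
    allᵇ⇒All (x ∷ xs) ok with Q x in eq
    ... | true = eq ∷ allᵇ⇒All xs ok

    All⇒allᵇ : ∀ {xs} → All (λ x → Q x ≡ true) xs → allᵇ Q xs ≡ true
    All⇒allᵇ []       = refl
    All⇒allᵇ (q ∷ qs) rewrite q = All⇒allᵇ qs

    allᵇ-++ : ∀ xs ys → allᵇ Q (xs ++ ys) ≡ allᵇ Q xs ∧ allᵇ Q ys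
    allᵇ-++ []       ys = refl
    allᵇ-++ (x ∷ xs) ys = trans (cong (Q x ∧_) (allᵇ-++ xs ys)) (sym (∧-assoc (Q x) _ _))

  bool-ext : ∀ {a b : Bool} → (a ≡ true → b ≡ true) → (b ≡ true → a ≡ true) → a ≡ b
  bool-ext {false} {false} _ _ = refl
  bool-ext {false} {true}  _ g = g refl
  bool-ext {true}  {false} h _ = sym (h refl)
  bool-ext {true}  {true}  _ _ = refl

  <ᵇ-true : ∀ {i N} → i < N → (i <ᵇ N) ≡ true
  <ᵇ-true i<N = Equivalence.to T-≡ (<⇒<ᵇ i<N)

  <ᵇ-false : ∀ {i N} → i < N → (N <ᵇ i) ≡ false
  <ᵇ-false {zero}  {N}     _       = refl
  <ᵇ-false {suc i} {suc N} (s≤s p) = <ᵇ-false p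

  ≡ᵇ-true⇒≡ : ∀ {m n} → (m ≡ᵇ n) ≡ true → m ≡ n
  ≡ᵇ-true⇒≡ {m} {n} eq = ≡ᵇ⇒≡ m n (Equivalence.from T-≡ eq)

  ≢⇒≡ᵇ-false : ∀ {m n} → m ≢ n → (m ≡ᵇ n) ≡ false
  ≢⇒≡ᵇ-false {m} {n} m≢n with m ≡ᵇ n in eq
  ... | true  = ⊥-elim (m≢n (≡ᵇ-true⇒≡ eq))
  ... | false = refl

  ≡ᵇ-refl : ∀ v → (v ≡ᵇ v) ≡ true
  ≡ᵇ-refl v = Equivalence.to T-≡ (≡⇒≡ᵇ v v refl)

  -- Inserting an entry of maximal index into a coloured word

  Below : {A : Set} → ℕ → ℕ × A → Set
  Below N y = proj₁ y < N

  <ᶜ-top : ∀ {N} y → Below N y → (y <ᶜ (N , 0)) ≡ true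
  <ᶜ-top (i , zero)  p = <ᵇ-true p
  <ᶜ-top (i , suc d) p = refl

  top-≮ᶜ : ∀ {N} y → Below N y → ((N , 0) <ᶜ y) ≡ false
  top-≮ᶜ (i , zero)  p = <ᵇ-false p
  top-≮ᶜ (i , suc d) p = refl

  ≮ᶜ-bottom : ∀ {N} c y → Below N y → (y <ᶜ (N , suc c)) ≡ false
  ≮ᶜ-bottom c (i , zero)  p = refl
  ≮ᶜ-bottom c (i , suc d) p rewrite <ᵇ-false p | ≢⇒≡ᵇ-false (<⇒≢ p) = refl

  bottom-<ᶜ : ∀ {N} c y → Below N y → ((N , suc c) <ᶜ y) ≡ true
  bottom-<ᶜ c (i , zero)  p = refl
  bottom-<ᶜ c (i , suc d) p rewrite <ᵇ-true p = refl

  invW-insert-top : ∀ N as bs → All (Below N) as → All (Below N) bs →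
                    invW (as ++ (N , 0) ∷ bs) ≡ invW (as ++ bs) + length bs
  invW-insert-top N []       bs _ pb =
    trans (cong (λ l → length l + invW bs) (filterᵇ-all _ <ᶜ-top pb)) (+-comm (length bs) (invW bs))
  invW-insert-top N (a ∷ as) bs (ia ∷ pa) pb =
    trans (cong₂ _+_ (length-filterᵇ-reject (_<ᶜ a) as bs (N , 0) (top-≮ᶜ a ia)) (invW-insert-top N as bs pa pb))
          (sym (+-assoc _ (invW (as ++ bs)) (length bs)))

  invW-insert-bottom : ∀ N c as bs → All (Below N) as → All (Below N) bs →
                       invW (as ++ (N , suc c) ∷ bs) ≡ invW (as ++ bs) + length as
  invW-insert-bottom N c []       bs _ pb =
    trans (cong (λ l → length l + invW bs) (filterᵇ-none _ (≮ᶜ-bottom c) pb)) (sym (+-identityʳ (invW bs)))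
  invW-insert-bottom N c (a ∷ as) bs (ia ∷ pa) pb =
    trans (cong₂ _+_ (length-filterᵇ-accept (_<ᶜ a) as bs (N , suc c) (bottom-<ᶜ c a ia))
                     (invW-insert-bottom N c as bs pa pb))
          (shift _ (invW (as ++ bs)) (length as))
    where
    shift : ∀ x y z → suc x + (y + z) ≡ (x + y) + suc z
    shift = solve-∀

  colPart-++ : ∀ as bs → colPart (as ++ bs) ≡ colPart as + colPart bs
  colPart-++ []                bs = refl
  colPart-++ ((s , zero)  ∷ as) bs = colPart-++ as bs
  colPart-++ ((s , suc c) ∷ as) bs = trans (cong (s + c +_) (colPart-++ as bs)) (sym (+-assoc (s + c) _ _))

  colW-++ : ∀ as bs → colW (as ++ bs) ≡ colW as + colW bs
  colW-++ []            bs = refl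
  colW-++ ((s , c) ∷ as) bs = trans (cong (c +_) (colW-++ as bs)) (sym (+-assoc c _ _))

  colW-insert : ∀ as bs e → colW (as ++ e ∷ bs) ≡ proj₂ e + colW (as ++ bs)
  colW-insert as bs (s , c) rewrite colW-++ as ((s , c) ∷ bs) | colW-++ as bs = x∙yz≈y∙xz (colW as) c (colW bs)

  ℓG-insert-top : ∀ N as bs → All (Below N) as → All (Below N) bs →
                  ℓG (as ++ (N , 0) ∷ bs) ≡ ℓG (as ++ bs) + length bs
  ℓG-insert-top N as bs pa pb
    rewrite invW-insert-top N as bs pa pb | colPart-++ as ((N , 0) ∷ bs) | colPart-++ as bs =
    xy∙z≈xz∙y (invW (as ++ bs)) (length bs) (colPart as + colPart bs)

  ℓG-insert-bottom : ∀ N c as bs → All (Below N) as → All (Below N) bs →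
                     ℓG (as ++ (N , suc c) ∷ bs) ≡ ℓG (as ++ bs) + (length as + (N + c))
  ℓG-insert-bottom N c as bs pa pb
    rewrite invW-insert-bottom N c as bs pa pb | colPart-++ as ((N , suc c) ∷ bs) | colPart-++ as bs =
    rearrange (invW (as ++ bs)) (length as) (colPart as) (N + c) (colPart bs)
    where
    rearrange : ∀ i l p q r → i + l + (p + (q + r)) ≡ i + (p + r) + (l + q)
    rearrange = solve-∀

  insertᶜ-↭ : ∀ x l → insertᶜ x l ↭ x ∷ l
  insertᶜ-↭ x []       = ↭-refl
  insertᶜ-↭ x (y ∷ l) with y <ᶜ x
  ... | true  = ↭-trans (prep y (insertᶜ-↭ x l)) (swap y x ↭-refl)
  ... | false = ↭-refl

  sortᶜ-↭ : ∀ l → sortᶜ l ↭ l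
  sortᶜ-↭ []      = ↭-refl
  sortᶜ-↭ (x ∷ l) = ↭-trans (insertᶜ-↭ x (sortᶜ l)) (prep x (sortᶜ-↭ l))

  insertᶜ-∷ʳ-top : ∀ N x l → Below N x → insertᶜ x (l ++ [ (N , 0) ]) ≡ insertᶜ x l ++ [ (N , 0) ]
  insertᶜ-∷ʳ-top N x []      ix rewrite top-≮ᶜ x ix = refl
  insertᶜ-∷ʳ-top N x (y ∷ l) ix with y <ᶜ x
  ... | true  = cong (y ∷_) (insertᶜ-∷ʳ-top N x l ix)
  ... | false = refl

  sortᶜ-∷ʳ-top : ∀ N l → All (Below N) l → sortᶜ (l ++ [ (N , 0) ]) ≡ sortᶜ l ++ [ (N , 0) ]
  sortᶜ-∷ʳ-top N []      []         = refl
  sortᶜ-∷ʳ-top N (x ∷ l) (ix ∷ pl) =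
    trans (cong (insertᶜ x) (sortᶜ-∷ʳ-top N l pl)) (insertᶜ-∷ʳ-top N x (sortᶜ l) ix)

  sortᶜ-∷ʳ-bottom : ∀ N c l → All (Below N) l → sortᶜ (l ++ [ (N , suc c) ]) ≡ (N , suc c) ∷ sortᶜ l
  sortᶜ-∷ʳ-bottom N c []      []         = refl
  sortᶜ-∷ʳ-bottom N c (x ∷ l) (ix ∷ pl) rewrite sortᶜ-∷ʳ-bottom N c l pl | bottom-<ᶜ c x ix = refl

  -- The blocks of π(f)

  hasValue : ℕ → ℕ × (ℕ × ℕ) → Bool
  hasValue ν t = proj₁ (proj₂ t) ≡ᵇ ν

  colouredIndex : ℕ × (ℕ × ℕ) → ℕ × ℕ
  colouredIndex t = proj₁ t , proj₂ (proj₂ t)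

  unsortedBlockFrom : ∀ {n} → ℕ → Vec (ℕ × ℕ) n → ℕ → List (ℕ × ℕ)
  unsortedBlockFrom s f ν = map colouredIndex (filterᵇ (hasValue ν) (indexedFrom s f))

  indexedFrom-∷ʳ : ∀ {n} s (f : Vec (ℕ × ℕ) n) e →
                   indexedFrom s (f ∷ʳ e) ≡ indexedFrom s f ++ [ (s + n , e) ]
  indexedFrom-∷ʳ     s []      e rewrite +-identityʳ s = refl
  indexedFrom-∷ʳ {suc n} s (e′ ∷ f) e rewrite +-suc s n = cong ((s , e′) ∷_) (indexedFrom-∷ʳ (suc s) f e)

  indexedFrom-Below : ∀ {n} s (f : Vec (ℕ × ℕ) n) → All (Below (s + n)) (indexedFrom s f)
  indexedFrom-Below     s []      = []
  indexedFrom-Below {suc n} s (e ∷ f) rewrite +-suc s n = s≤s (m≤m+n s n) ∷ indexedFrom-Below (suc s) f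

  block-Below : ∀ {n} (f : Vec (ℕ × ℕ) n) ν → All (Below (suc n)) (block f ν)
  block-Below f ν = All-resp-↭ (↭-sym (sortᶜ-↭ (unsortedBlockFrom 1 f ν))) (unsortedBlock-Below f ν)
    where
    unsortedBlock-Below : ∀ {n} (f : Vec (ℕ × ℕ) n) ν → All (Below (suc n)) (unsortedBlockFrom 1 f ν)
    unsortedBlock-Below f ν = map⁺ (filter⁺ (T? ∘ hasValue ν) (indexedFrom-Below 1 f))

  length-block : ∀ {n} (f : Vec (ℕ × ℕ) n) ν → length (block f ν) ≡ cnt ν f
  length-block f ν = trans (↭-length (sortᶜ-↭ (unsortedBlockFrom 1 f ν))) (length-unsortedBlockFrom 1 f)
    where
    length-unsortedBlockFrom : ∀ {n} s (f : Vec (ℕ × ℕ) n) → length (unsortedBlockFrom s f ν) ≡ cnt ν f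
    length-unsortedBlockFrom s []      = refl
    length-unsortedBlockFrom s (e ∷ f) with proj₁ e ≡ᵇ ν
    ... | true  = cong suc (length-unsortedBlockFrom (suc s) f)
    ... | false = length-unsortedBlockFrom (suc s) f

  unsortedBlock-∷ʳ : ∀ {n} (f : Vec (ℕ × ℕ) n) v c ν →
    unsortedBlockFrom 1 (f ∷ʳ (v , c)) ν ≡ unsortedBlockFrom 1 f ν ++ (if v ≡ᵇ ν then [ (suc n , c) ] else [])
  unsortedBlock-∷ʳ {n} f v c ν
    rewrite indexedFrom-∷ʳ 1 f (v , c)
          | filter-++ (T? ∘ hasValue ν) (indexedFrom 1 f) [ (suc n , (v , c)) ]
          | map-++ colouredIndex (filterᵇ (hasValue ν) (indexedFrom 1 f)) (filterᵇ (hasValue ν) [ (suc n , (v , c)) ])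
    with v ≡ᵇ ν
  ... | true  = refl
  ... | false = refl

  block-∷ʳ-other : ∀ {n} (f : Vec (ℕ × ℕ) n) v c ν → (v ≡ᵇ ν) ≡ false →
                   block (f ∷ʳ (v , c)) ν ≡ block f ν
  block-∷ʳ-other f v c ν v≢ν rewrite unsortedBlock-∷ʳ f v c ν | v≢ν =
    cong sortᶜ (++-identityʳ (unsortedBlockFrom 1 f ν))

  block-∷ʳ-top : ∀ {n} (f : Vec (ℕ × ℕ) n) v → block (f ∷ʳ (v , 0)) v ≡ block f v ++ [ (suc n , 0) ]
  block-∷ʳ-top {n} f v rewrite unsortedBlock-∷ʳ f v 0 v | ≡ᵇ-refl v =
    sortᶜ-∷ʳ-top (suc n) _ (map⁺ (filter⁺ (T? ∘ hasValue v) (indexedFrom-Below 1 f)))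

  block-∷ʳ-bottom : ∀ {n} (f : Vec (ℕ × ℕ) n) v c →
                    block (f ∷ʳ (v , suc c)) v ≡ (suc n , suc c) ∷ block f v
  block-∷ʳ-bottom {n} f v c rewrite unsortedBlock-∷ʳ f v (suc c) v | ≡ᵇ-refl v =
    sortᶜ-∷ʳ-bottom (suc n) c _ (map⁺ (filter⁺ (T? ∘ hasValue v) (indexedFrom-Below 1 f)))

  blocksBelow : ∀ {n} → Vec (ℕ × ℕ) n → ℕ → List (ℕ × ℕ)
  blocksBelow f v = concatMap (block f) (upTo v)

  blocksAbove : ∀ {n} → Vec (ℕ × ℕ) n → ℕ → ℕ → List (ℕ × ℕ)
  blocksAbove f v b = concatMap (block f) (applyUpTo (suc v +_) (b ∸ suc v))

  πf-split : ∀ {n} (f : Vec (ℕ × ℕ) n) {v b} → v < b →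
             πf b f ≡ blocksBelow f v ++ block f v ++ blocksAbove f v b
  πf-split f {v} v<b =
    trans (cong (concatMap (block f)) (applyUpTo-split id v<b)) (concatMap-++ (block f) (upTo v) _)

  module _ {n : ℕ} (f : Vec (ℕ × ℕ) n) where

    blocksBelow-∷ʳ : ∀ v c → blocksBelow (f ∷ʳ (v , c)) v ≡ blocksBelow f v
    blocksBelow-∷ʳ v c = concatMap-cong-local (applyUpTo⁺₁ id v
      (λ j<v → block-∷ʳ-other f v c _ (≢⇒≡ᵇ-false (>⇒≢ j<v))))

    blocksAbove-∷ʳ : ∀ v c b → blocksAbove (f ∷ʳ (v , c)) v b ≡ blocksAbove f v b
    blocksAbove-∷ʳ v c b = concatMap-cong-local (applyUpTo⁺₂ (suc v +_) (b ∸ suc v)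
      (λ i → block-∷ʳ-other f v c _ (≢⇒≡ᵇ-false (<⇒≢ (s≤s (m≤m+n v i))))))

    concatMap-block-Below : ∀ νs → All (Below (suc n)) (concatMap (block f) νs)
    concatMap-block-Below νs = concat⁺ (map⁺ (universal (block-Below f) νs))

    module _ {v b : ℕ} (v<b : v < b) where

      πf-∷ʳ : ∀ c → πf b (f ∷ʳ (v , c)) ≡ blocksBelow f v ++ block (f ∷ʳ (v , c)) v ++ blocksAbove f v b
      πf-∷ʳ c = trans (πf-split (f ∷ʳ (v , c)) v<b)
        (cong₂ (λ as bs → as ++ block (f ∷ʳ (v , c)) v ++ bs) (blocksBelow-∷ʳ v c) (blocksAbove-∷ʳ v c b))

      πf-∷ʳ-top : πf b (f ∷ʳ (v , 0)) ≡ (blocksBelow f v ++ block f v) ++ (suc n , 0) ∷ blocksAbove f v b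
      πf-∷ʳ-top rewrite πf-∷ʳ 0 | block-∷ʳ-top f v
                      | ++-assoc (block f v) [ (suc n , 0) ] (blocksAbove f v b) =
        sym (++-assoc (blocksBelow f v) (block f v) _)

      πf-∷ʳ-bottom : ∀ c →
        πf b (f ∷ʳ (v , suc c)) ≡ blocksBelow f v ++ (suc n , suc c) ∷ block f v ++ blocksAbove f v b
      πf-∷ʳ-bottom c rewrite πf-∷ʳ (suc c) | block-∷ʳ-bottom f v c = refl

      private
        below-Below : All (Below (suc n)) (blocksBelow f v)
        below-Below = concatMap-block-Below (upTo v)

        above-Below : All (Below (suc n)) (blocksAbove f v b)
        above-Below = concatMap-block-Below (applyUpTo (suc v +_) (b ∸ suc v))

        πf-reassoc : πf b f ≡ (blocksBelow f v ++ block f v) ++ blocksAbove f v b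
        πf-reassoc = trans (πf-split f v<b) (sym (++-assoc (blocksBelow f v) (block f v) _))

      ℓG-πf-∷ʳ-top : ℓG (πf b (f ∷ʳ (v , 0))) ≡ ℓG (πf b f) + length (blocksAbove f v b)
      ℓG-πf-∷ʳ-top rewrite πf-∷ʳ-top | πf-reassoc =
        ℓG-insert-top (suc n) _ _ (++⁺ below-Below (block-Below f v)) above-Below

      ℓG-πf-∷ʳ-bottom : ∀ c →
        ℓG (πf b (f ∷ʳ (v , suc c))) ≡ ℓG (πf b f) + (length (blocksBelow f v) + (suc n + c))
      ℓG-πf-∷ʳ-bottom c rewrite πf-∷ʳ-bottom c | πf-split f v<b =
        ℓG-insert-bottom (suc n) c _ _ below-Below (++⁺ (block-Below f v) above-Below)

      colW-πf-∷ʳ : ∀ c → colW (πf b (f ∷ʳ (v , c))) ≡ c + colW (πf b f)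
      colW-πf-∷ʳ zero    rewrite πf-∷ʳ-top | πf-reassoc = colW-insert (blocksBelow f v ++ block f v) _ _
      colW-πf-∷ʳ (suc c) rewrite πf-∷ʳ-bottom c | πf-split f v<b = colW-insert (blocksBelow f v) _ _

  πf-empty : ∀ b → πf b [] ≡ []
  πf-empty b = no-blocks (upTo b)
    where
    no-blocks : ∀ νs → concatMap (block []) νs ≡ []
    no-blocks []       = refl
    no-blocks (_ ∷ νs) = no-blocks νs

  -- Compositions, indexed by ℕ rather than Fin; out-of-range positions read as 0

  lookupℕ : ∀ {m} → Vec ℕ m → ℕ → ℕ
  lookupℕ []       _       = 0
  lookupℕ (x ∷ xs) zero    = x
  lookupℕ (x ∷ xs) (suc j) = lookupℕ xs j

  decrementAt : ∀ {m} → Vec ℕ m → ℕ → Vec ℕ m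
  decrementAt []       _       = []
  decrementAt (x ∷ xs) zero    = pred x ∷ xs
  decrementAt (x ∷ xs) (suc v) = x ∷ decrementAt xs v

  sumBefore : ∀ {m} → Vec ℕ m → ℕ → ℕ
  sumBefore []       _       = 0
  sumBefore (x ∷ xs) zero    = 0
  sumBefore (x ∷ xs) (suc v) = x + sumBefore xs v

  sumAfter : ∀ {m} → Vec ℕ m → ℕ → ℕ
  sumAfter []       _       = 0
  sumAfter (x ∷ xs) zero    = sumℕ (toList xs)
  sumAfter (x ∷ xs) (suc v) = sumAfter xs v

  positive : ℕ → Bool
  positive zero    = false
  positive (suc _) = true

  suc-pred-positive : ∀ {m} → positive m ≡ true → suc (pred m) ≡ m
  suc-pred-positive {suc m} _ = refl

  lookup≡lookupℕ : ∀ {m} (xs : Vec ℕ m) j → lookup xs j ≡ lookupℕ xs (toℕ j)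
  lookup≡lookupℕ (x ∷ xs) Fin.zero    = refl
  lookup≡lookupℕ (x ∷ xs) (Fin.suc j) = lookup≡lookupℕ xs j

  lookupℕ-decrementAt : ∀ {m} (xs : Vec ℕ m) v → lookupℕ (decrementAt xs v) v ≡ pred (lookupℕ xs v)
  lookupℕ-decrementAt []       v       = refl
  lookupℕ-decrementAt (x ∷ xs) zero    = refl
  lookupℕ-decrementAt (x ∷ xs) (suc v) = lookupℕ-decrementAt xs v

  lookupℕ-decrementAt-other : ∀ {m} (xs : Vec ℕ m) {v j} → v ≢ j →
                              lookupℕ (decrementAt xs v) j ≡ lookupℕ xs j
  lookupℕ-decrementAt-other []       {v}     {j}     _   = refl
  lookupℕ-decrementAt-other (x ∷ xs) {zero}  {zero}  v≢j = ⊥-elim (v≢j refl)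
  lookupℕ-decrementAt-other (x ∷ xs) {zero}  {suc j} _   = refl
  lookupℕ-decrementAt-other (x ∷ xs) {suc v} {zero}  _   = refl
  lookupℕ-decrementAt-other (x ∷ xs) {suc v} {suc j} v≢j = lookupℕ-decrementAt-other xs (v≢j ∘ cong suc)

  sumBefore-decrementAt : ∀ {m} (xs : Vec ℕ m) v → sumBefore (decrementAt xs v) v ≡ sumBefore xs v
  sumBefore-decrementAt []       v       = refl
  sumBefore-decrementAt (x ∷ xs) zero    = refl
  sumBefore-decrementAt (x ∷ xs) (suc v) = cong (x +_) (sumBefore-decrementAt xs v)

  sumAfter-decrementAt : ∀ {m} (xs : Vec ℕ m) v → sumAfter (decrementAt xs v) v ≡ sumAfter xs v
  sumAfter-decrementAt []       v       = refl
  sumAfter-decrementAt (x ∷ xs) zero    = refl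
  sumAfter-decrementAt (x ∷ xs) (suc v) = sumAfter-decrementAt xs v

  sumℕ-decrementAt : ∀ {m} (xs : Vec ℕ m) v → positive (lookupℕ xs v) ≡ true →
                     sumℕ (toList xs) ≡ suc (sumℕ (toList (decrementAt xs v)))
  sumℕ-decrementAt (suc x ∷ xs) zero    _   = refl
  sumℕ-decrementAt (x ∷ xs)     (suc v) pos = trans (cong (x +_) (sumℕ-decrementAt xs v pos)) (+-suc x _)

  lookupℕ-sumℕ≡0 : ∀ {m} (xs : Vec ℕ m) → sumℕ (toList xs) ≡ 0 → ∀ j → lookupℕ xs j ≡ 0
  lookupℕ-sumℕ≡0 []       _     j       = refl
  lookupℕ-sumℕ≡0 (x ∷ xs) sum≡0 zero    = m+n≡0⇒m≡0 x sum≡0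
  lookupℕ-sumℕ≡0 (x ∷ xs) sum≡0 (suc j) = lookupℕ-sumℕ≡0 xs (m+n≡0⇒n≡0 x sum≡0) j

  sumℕ-map-upTo : ∀ {m} (xs : Vec ℕ m) {v} → v ≤ m → sumℕ (map (lookupℕ xs) (upTo v)) ≡ sumBefore xs v
  sumℕ-map-upTo []       {zero}  _       = refl
  sumℕ-map-upTo (x ∷ xs) {zero}  _       = refl
  sumℕ-map-upTo (x ∷ xs) {suc v} (s≤s p) =
    cong (x +_) (trans (cong sumℕ (map-applyUpTo-shift (lookupℕ (x ∷ xs)) id v)) (sumℕ-map-upTo xs p))

  sumBefore-length : ∀ {m} (xs : Vec ℕ m) → sumBefore xs m ≡ sumℕ (toList xs)
  sumBefore-length []       = refl
  sumBefore-length (x ∷ xs) = cong (x +_) (sumBefore-length xs)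

  sumℕ-map-above : ∀ {m} (xs : Vec ℕ m) {v} → v < m →
                   sumℕ (map (lookupℕ xs) (applyUpTo (suc v +_) (m ∸ suc v))) ≡ sumAfter xs v
  sumℕ-map-above {suc m} (x ∷ xs) {zero}  _       =
    trans (cong sumℕ (map-applyUpTo-shift (lookupℕ (x ∷ xs)) id m))
          (trans (sumℕ-map-upTo xs ≤-refl) (sumBefore-length xs))
  sumℕ-map-above {suc m} (x ∷ xs) {suc v} (s≤s p) =
    trans (cong sumℕ (map-applyUpTo-shift (lookupℕ (x ∷ xs)) (suc v +_) (m ∸ suc v))) (sumℕ-map-above xs p)

  -- Membership in N₀^(r,n)(n̲)

  cnt-∷ʳ : ∀ {n} (f : Vec (ℕ × ℕ) n) v c j → cnt j (f ∷ʳ (v , c)) ≡ cnt j f + (if v ≡ᵇ j then 1 else 0)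
  cnt-∷ʳ f v c j rewrite toList-∷ʳ (v , c) f
    | filter-++ (T? ∘ λ e → proj₁ e ≡ᵇ j) (toList f) [ (v , c) ]
    | length-++ (filterᵇ (λ e → proj₁ e ≡ᵇ j) (toList f)) {filterᵇ (λ e → proj₁ e ≡ᵇ j) [ (v , c) ]}
    with v ≡ᵇ j
  ... | true  = refl
  ... | false = refl

  cnt-∷ʳ-same : ∀ {n} (f : Vec (ℕ × ℕ) n) v c → cnt v (f ∷ʳ (v , c)) ≡ suc (cnt v f)
  cnt-∷ʳ-same f v c rewrite cnt-∷ʳ f v c v | ≡ᵇ-refl v = +-comm (cnt v f) 1

  cnt-∷ʳ-other : ∀ {n} (f : Vec (ℕ × ℕ) n) {v} c {j} → v ≢ j → cnt j (f ∷ʳ (v , c)) ≡ cnt j f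
  cnt-∷ʳ-other f {v} c {j} v≢j rewrite cnt-∷ʳ f v c j | ≢⇒≡ᵇ-false v≢j = +-identityʳ (cnt j f)

  HasCounts : ∀ {n k} → Vec ℕ (suc k) → Vec (ℕ × ℕ) n → Set
  HasCounts {k = k} comp f = ∀ {j} → j < suc k → cnt j f ≡ lookupℕ comp j

  module _ {n k : ℕ} (comp : Vec ℕ (suc k)) (f : Vec (ℕ × ℕ) n) {v : ℕ} (c : ℕ) (v≤k : v < suc k) where

    HasCounts-∷ʳ⁻ : HasCounts comp (f ∷ʳ (v , c)) →
                    positive (lookupℕ comp v) ≡ true × HasCounts (decrementAt comp v) f
    HasCounts-∷ʳ⁻ h = comp-v-positive , counts
      where
      comp-v≡ : lookupℕ comp v ≡ suc (cnt v f)
      comp-v≡ = trans (sym (h v≤k)) (cnt-∷ʳ-same f v c)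

      comp-v-positive : positive (lookupℕ comp v) ≡ true
      comp-v-positive rewrite comp-v≡ = refl

      counts : HasCounts (decrementAt comp v) f
      counts {j} j≤k with v ≟ j
      ... | yes refl = sym (trans (lookupℕ-decrementAt comp v) (cong pred comp-v≡))
      ... | no  v≢j  =
        trans (sym (cnt-∷ʳ-other f c v≢j)) (trans (h j≤k) (sym (lookupℕ-decrementAt-other comp v≢j)))

    HasCounts-∷ʳ⁺ : positive (lookupℕ comp v) ≡ true → HasCounts (decrementAt comp v) f →
                    HasCounts comp (f ∷ʳ (v , c))
    HasCounts-∷ʳ⁺ pos h {j} j≤k with v ≟ j
    ... | yes refl = trans (cnt-∷ʳ-same f v c)
                           (trans (cong suc (trans (h v≤k) (lookupℕ-decrementAt comp v))) (suc-pred-positive pos))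
    ... | no  v≢j  = trans (cnt-∷ʳ-other f c v≢j) (trans (h j≤k) (lookupℕ-decrementAt-other comp v≢j))

  countsOK : ∀ {n k} → Vec ℕ (suc k) → Vec (ℕ × ℕ) n → Bool
  countsOK {k = k} comp f = allᵇ (λ j → cnt (toℕ j) f ≡ᵇ lookup comp j) (allFin (suc k))

  module _ {n k : ℕ} (comp : Vec ℕ (suc k)) (f : Vec (ℕ × ℕ) n) where

    countsOK⇒HasCounts : countsOK comp f ≡ true → HasCounts comp f
    countsOK⇒HasCounts ok {j} j≤k =
      subst (λ i → cnt i f ≡ lookupℕ comp i) (toℕ-fromℕ< j≤k)
        (trans (≡ᵇ-true⇒≡ (tabulate⁻ {f = id} (allᵇ⇒All _ (allFin (suc k)) ok) (fromℕ< j≤k)))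
               (lookup≡lookupℕ comp (fromℕ< j≤k)))

    HasCounts⇒countsOK : HasCounts comp f → countsOK comp f ≡ true
    HasCounts⇒countsOK h = All⇒allᵇ _ (tabulate⁺ {f = id} (λ j →
      Equivalence.to T-≡ (≡⇒≡ᵇ _ _ (trans (h (toℕ<n j)) (sym (lookup≡lookupℕ comp j))))))

  module _ {n k : ℕ} (comp : Vec ℕ (suc k)) (f : Vec (ℕ × ℕ) n) {v : ℕ} (c : ℕ) (v≤k : v < suc k) where

    countsOK-∷ʳ : countsOK comp (f ∷ʳ (v , c)) ≡ countsOK (decrementAt comp v) f ∧ positive (lookupℕ comp v)
    countsOK-∷ʳ = bool-ext to from
      where
      to : countsOK comp (f ∷ʳ (v , c)) ≡ true →
           countsOK (decrementAt comp v) f ∧ positive (lookupℕ comp v) ≡ true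
      to ok with HasCounts-∷ʳ⁻ comp f c v≤k (countsOK⇒HasCounts comp (f ∷ʳ (v , c)) ok)
      ... | pos , h rewrite HasCounts⇒countsOK (decrementAt comp v) f h = pos
      from : countsOK (decrementAt comp v) f ∧ positive (lookupℕ comp v) ≡ true →
             countsOK comp (f ∷ʳ (v , c)) ≡ true
      from ok = HasCounts⇒countsOK comp (f ∷ʳ (v , c))
        (HasCounts-∷ʳ⁺ comp f c v≤k (∧-conicalʳ _ _ ok)
                                    (countsOK⇒HasCounts (decrementAt comp v) f (∧-conicalˡ _ _ ok)))

    inSet-∷ʳ : inSet comp (f ∷ʳ (v , c)) ≡
               inSet (decrementAt comp v) f ∧ (colorOK (v , c) ∧ positive (lookupℕ comp v))
    inSet-∷ʳ = trans (cong₂ _∧_ colours countsOK-∷ʳ)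
      (∧-interchange (allᵇ colorOK (toList f)) (colorOK (v , c))
                     (countsOK (decrementAt comp v) f) (positive (lookupℕ comp v)))
      where
      colours : allᵇ colorOK (toList (f ∷ʳ (v , c))) ≡ allᵇ colorOK (toList f) ∧ colorOK (v , c)
      colours = trans (cong (allᵇ colorOK) (toList-∷ʳ (v , c) f))
                      (trans (allᵇ-++ colorOK (toList f) [ (v , c) ])
                             (cong (allᵇ colorOK (toList f) ∧_) (∧-identityʳ _)))

  inSet⇒HasCounts : ∀ {n k} (comp : Vec ℕ (suc k)) (f : Vec (ℕ × ℕ) n) →
                    inSet comp f ≡ true → HasCounts comp f
  inSet⇒HasCounts comp f ok = countsOK⇒HasCounts comp f (∧-conicalʳ (allᵇ colorOK (toList f)) _ ok)

  inSet-empty : ∀ {k} (comp : Vec ℕ (suc k)) → sumℕ (toList comp) ≡ 0 → inSet comp [] ≡ true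
  inSet-empty comp sum≡0 = HasCounts⇒countsOK comp [] (λ {j} _ → sym (lookupℕ-sumℕ≡0 comp sum≡0 j))

  module _ {n k : ℕ} (comp : Vec ℕ (suc k)) (f : Vec (ℕ × ℕ) n) (counts : HasCounts comp f)
           {v : ℕ} (v≤k : v < suc k) where

    length-block≡lookupℕ : ∀ {j} → j < suc k → length (block f j) ≡ lookupℕ comp j
    length-block≡lookupℕ j≤k = trans (length-block f _) (counts j≤k)

    length-blocksBelow : length (blocksBelow f v) ≡ sumBefore comp v
    length-blocksBelow = begin
      length (blocksBelow f v)                  ≡⟨ length-concatMap (block f) (upTo v) ⟩
      sumℕ (map (length ∘ block f) (upTo v))    ≡⟨ cong sumℕ (map-cong-local (applyUpTo⁺₁ id v
                                                     (λ j<v → length-block≡lookupℕ (<-trans j<v v≤k)))) ⟩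
      sumℕ (map (lookupℕ comp) (upTo v))        ≡⟨ sumℕ-map-upTo comp (<⇒≤ v≤k) ⟩
      sumBefore comp v                          ∎
      where open ≡.≡-Reasoning

    length-blocksAbove : length (blocksAbove f v (suc k)) ≡ sumAfter comp v
    length-blocksAbove = begin
      length (blocksAbove f v (suc k))          ≡⟨ length-concatMap (block f) above ⟩
      sumℕ (map (length ∘ block f) above)       ≡⟨ cong sumℕ (map-cong-local (applyUpTo⁺₁ (suc v +_) (k ∸ v)
                                                     (λ i<k∸v → length-block≡lookupℕ (in-range i<k∸v)))) ⟩
      sumℕ (map (lookupℕ comp) above)           ≡⟨ sumℕ-map-above comp v≤k ⟩
      sumAfter comp v                           ∎
      where
      open ≡.≡-Reasoning
      above : List ℕ
      above = applyUpTo (suc v +_) (k ∸ v)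
      in-range : ∀ {i} → i < k ∸ v → suc v + i < suc k
      in-range {i} i<k∸v =
        s≤s (subst (_≤ k) (cong suc (+-comm i v)) (m≤o∸n⇒m+n≤o (suc i) (≤-pred v≤k) i<k∸v))

    invF-∷ʳ-top : invF k (f ∷ʳ (v , 0)) ≡ invF k f + sumAfter comp v
    invF-∷ʳ-top = trans (ℓG-πf-∷ʳ-top f v≤k) (cong (invF k f +_) length-blocksAbove)

    invF-∷ʳ-bottom : ∀ c → invF k (f ∷ʳ (v , suc c)) ≡ invF k f + (sumBefore comp v + (suc n + c))
    invF-∷ʳ-bottom c =
      trans (ℓG-πf-∷ʳ-bottom f v≤k c) (cong (λ l → invF k f + (l + (suc n + c))) length-blocksBelow)

open Combinatorics

module Semiring {c ℓ : Level} (R : CommutativeSemiring c ℓ) where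
  open CommutativeSemiring R
  open import Data.Bool using (Bool; true; false; _∧_; if_then_else_)
  open import Data.Bool.Properties using (∧-zeroʳ; ∧-identityʳ)
  open import Data.Nat using (ℕ; zero; suc; _<_; z≤n; s≤s) renaming (_+_ to _+ℕ_)
  import Data.Nat.Properties as ℕ
  open import Data.Product using (_×_; _,_)
  open import Data.List using (List; []; _∷_; [_]; _++_; map; concatMap; filterᵇ; upTo; applyUpTo)
  open import Data.List.Properties using (map-∘; map-++; map-applyUpTo; map-upTo; upTo-∷ʳ)
  open import Data.Vec using (Vec; []; _∷_; _∷ʳ_; toList)
  open import Relation.Binary.PropositionalEquality as ≡ using (_≡_)
  open import Function using (_∘_; id)
  open import Algebra.Properties.CommutativeSemigroup ℕ.+-commutativeSemigroup using (xy∙z≈xz∙y)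
  open import Algebra.Properties.CommutativeSemiring.Exp R using (_^_; ^-homo-*; ^-distrib-*)
  open import Relation.Binary.Reasoning.Setoid setoid
  open import Algebra.Solver.Ring.NaturalCoefficients.Default R

  ∑ : ∀ {A : Set} → List A → (A → Carrier) → Carrier
  ∑ xs g = sumR R (map g xs)

  ∑-++ : ∀ {A : Set} (xs ys : List A) (g : A → Carrier) → ∑ (xs ++ ys) g ≈ ∑ xs g + ∑ ys g
  ∑-++ []       ys g = sym (+-identityˡ _)
  ∑-++ (x ∷ xs) ys g = trans (+-congˡ (∑-++ xs ys g)) (sym (+-assoc _ _ _))

  ∑-concatMap : ∀ {A B : Set} (xs : List A) (h : A → List B) (g : B → Carrier) →
                ∑ (concatMap h xs) g ≈ ∑ xs (λ x → ∑ (h x) g)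
  ∑-concatMap []       h g = refl
  ∑-concatMap (x ∷ xs) h g = trans (∑-++ (h x) (concatMap h xs) g) (+-congˡ (∑-concatMap xs h g))

  ∑-cong : ∀ {A : Set} (xs : List A) {g h : A → Carrier} → (∀ x → g x ≈ h x) → ∑ xs g ≈ ∑ xs h
  ∑-cong []       g≈h = refl
  ∑-cong (x ∷ xs) g≈h = +-cong (g≈h x) (∑-cong xs g≈h)

  ∑-map : ∀ {A B : Set} (xs : List A) (h : A → B) (g : B → Carrier) → ∑ (map h xs) g ≈ ∑ xs (g ∘ h)
  ∑-map xs h g = reflexive (≡.cong (sumR R) (≡.sym (map-∘ xs)))

  ∑-applyUpTo : ∀ (f : ℕ → ℕ) n (g : ℕ → Carrier) → ∑ (applyUpTo f n) g ≈ ∑ (upTo n) (g ∘ f)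
  ∑-applyUpTo f n g =
    reflexive (≡.cong (sumR R) (≡.trans (map-applyUpTo f g n) (≡.sym (map-upTo (g ∘ f) n))))

  ∑-0 : ∀ {A : Set} (xs : List A) → ∑ xs (λ _ → 0#) ≈ 0#
  ∑-0 []       = refl
  ∑-0 (x ∷ xs) = trans (+-identityˡ _) (∑-0 xs)

  ∑-+ : ∀ {A : Set} (xs : List A) (g h : A → Carrier) → ∑ xs (λ x → g x + h x) ≈ ∑ xs g + ∑ xs h
  ∑-+ []       g h = sym (+-identityˡ _)
  ∑-+ (x ∷ xs) g h = trans (+-congˡ (∑-+ xs g h))
    (solve 4 (λ a b c d → (a :+ b) :+ (c :+ d) := (a :+ c) :+ (b :+ d)) refl (g x) (h x) (∑ xs g) (∑ xs h))

  ∑-*ˡ : ∀ {A : Set} (xs : List A) (d : Carrier) (g : A → Carrier) → d * ∑ xs g ≈ ∑ xs (λ x → d * g x)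
  ∑-*ˡ []       d g = zeroʳ d
  ∑-*ˡ (x ∷ xs) d g = trans (distribˡ d _ _) (+-congˡ (∑-*ˡ xs d g))

  ∑-*ʳ : ∀ {A : Set} (xs : List A) (d : Carrier) (g : A → Carrier) → ∑ xs g * d ≈ ∑ xs (λ x → g x * d)
  ∑-*ʳ xs d g = trans (*-comm _ d) (trans (∑-*ˡ xs d g) (∑-cong xs (λ x → *-comm d (g x))))

  ∑-swap : ∀ {A B : Set} (xs : List A) (ys : List B) (F : A → B → Carrier) →
           ∑ xs (λ x → ∑ ys (F x)) ≈ ∑ ys (λ y → ∑ xs (λ x → F x y))
  ∑-swap []       ys F = sym (∑-0 ys)
  ∑-swap (x ∷ xs) ys F = trans (+-congˡ (∑-swap xs ys F)) (sym (∑-+ ys (F x) _))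

  guard : Bool → Carrier → Carrier
  guard b v = if b then v else 0#

  guard-cong : ∀ {b b′} y → b ≡ b′ → guard b y ≈ guard b′ y
  guard-cong y b≡b′ = reflexive (≡.cong (λ b → guard b y) b≡b′)

  guard-*ˡ : ∀ b X y → guard b (X * y) ≈ X * guard b y
  guard-*ˡ true  X y = refl
  guard-*ˡ false X y = sym (zeroʳ X)

  ∑-filterᵇ : ∀ {A : Set} (xs : List A) (Q : A → Bool) (g : A → Carrier) →
              ∑ (filterᵇ Q xs) g ≈ ∑ xs (λ x → guard (Q x) (g x))
  ∑-filterᵇ []       Q g = refl
  ∑-filterᵇ (x ∷ xs) Q g with Q x
  ... | true  = +-congˡ (∑-filterᵇ xs Q g)
  ... | false = trans (∑-filterᵇ xs Q g) (sym (+-identityˡ _))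

  ∑-guard-* : ∀ {A : Set} (xs : List A) b (h : A → Carrier) d →
              ∑ xs (λ x → guard b (h x * d)) ≈ guard b (∑ xs h * d)
  ∑-guard-* xs true  h d = sym (∑-*ʳ xs d h)
  ∑-guard-* xs false h d = ∑-0 xs

  ∑-cong-upTo : ∀ n {g h : ℕ → Carrier} → (∀ i → i < n → g i ≈ h i) → ∑ (upTo n) g ≈ ∑ (upTo n) h
  ∑-cong-upTo zero    g≈h = refl
  ∑-cong-upTo (suc n) {g} {h} g≈h = +-cong (g≈h 0 (s≤s z≤n))
    (trans (∑-applyUpTo suc n g)
           (trans (∑-cong-upTo n (λ i i<n → g≈h (suc i) (s≤s i<n))) (sym (∑-applyUpTo suc n h))))

  ∑-vecs-∷ʳ : ∀ {A : Set} n (xs : List A) (g : Vec A (suc n) → Carrier) →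
              ∑ (vecs (suc n) xs) g ≈ ∑ (vecs n xs) (λ f → ∑ xs (λ e → g (f ∷ʳ e)))
  ∑-vecs-∷ʳ zero xs g = trans (∑-concatMap xs _ g)
    (trans (∑-cong xs (λ x → +-identityʳ _)) (sym (+-identityʳ _)))
  ∑-vecs-∷ʳ (suc n) xs g = begin
    ∑ (vecs (suc (suc n)) xs) g
      ≈⟨ ∑-concatMap xs _ g ⟩
    ∑ xs (λ x → ∑ (map (x ∷_) (vecs (suc n) xs)) g)
      ≈⟨ ∑-cong xs (λ x → ∑-map (vecs (suc n) xs) (x ∷_) g) ⟩
    ∑ xs (λ x → ∑ (vecs (suc n) xs) (λ u → g (x ∷ u)))
      ≈⟨ ∑-cong xs (λ x → ∑-vecs-∷ʳ n xs (λ u → g (x ∷ u))) ⟩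
    ∑ xs (λ x → ∑ (vecs n xs) (λ w → ∑ xs (λ e → g (x ∷ (w ∷ʳ e)))))
      ≈⟨ ∑-cong xs (λ x → sym (∑-map (vecs n xs) (x ∷_) _)) ⟩
    ∑ xs (λ x → ∑ (map (x ∷_) (vecs n xs)) (λ f → ∑ xs (λ e → g (f ∷ʳ e))))
      ≈⟨ sym (∑-concatMap xs _ _) ⟩
    ∑ (vecs (suc n) xs) (λ f → ∑ xs (λ e → g (f ∷ʳ e))) ∎

  pow≡^ : ∀ y m → pow R y m ≡ y ^ m
  pow≡^ y zero    = ≡.refl
  pow≡^ y (suc m) = ≡.cong (y *_) (pow≡^ y m)

  pow-+ : ∀ y m n → pow R y (m +ℕ n) ≈ pow R y m * pow R y n
  pow-+ y m n rewrite pow≡^ y (m +ℕ n) | pow≡^ y m | pow≡^ y n = ^-homo-* y m n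

  pow-* : ∀ y z m → pow R (y * z) m ≈ pow R y m * pow R z m
  pow-* y z m rewrite pow≡^ (y * z) m | pow≡^ y m | pow≡^ z m = ^-distrib-* y z m

  qint-+ : ∀ p m n → qint R p (m +ℕ n) ≈ qint R p m + pow R p m * qint R p n
  qint-+ p m n = begin
    ∑ (upTo (m +ℕ n)) (pow R p)
      ≡⟨ ≡.cong (λ l → ∑ l (pow R p)) (applyUpTo-+ id m n) ⟩
    ∑ (upTo m ++ applyUpTo (m +ℕ_) n) (pow R p)
      ≈⟨ ∑-++ (upTo m) _ (pow R p) ⟩
    qint R p m + ∑ (applyUpTo (m +ℕ_) n) (pow R p)
      ≈⟨ +-congˡ (trans (∑-applyUpTo (m +ℕ_) n (pow R p)) (∑-cong (upTo n) (pow-+ p m))) ⟩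
    qint R p m + ∑ (upTo n) (λ i → pow R p m * pow R p i)
      ≈⟨ +-congˡ (sym (∑-*ˡ (upTo n) (pow R p m) (pow R p))) ⟩
    qint R p m + pow R p m * qint R p n ∎

  prodR-++ : ∀ xs ys → prodR R (xs ++ ys) ≈ prodR R xs * prodR R ys
  prodR-++ []       ys = sym (*-identityˡ _)
  prodR-++ (x ∷ xs) ys = trans (*-congˡ (prodR-++ xs ys)) (sym (*-assoc _ _ _))

  hatfact-suc : ∀ x p m →
    hatfact R x p (suc m) ≈ hatfact R x p m * ((1# + x * pow R p (suc m)) * qint R p (suc m))
  hatfact-suc x p m = begin
    negPoch R x p (suc m) * (qint R p (suc m) * qfact R p m)
      ≡⟨ ≡.cong (λ l → prodR R l * (qint R p (suc m) * qfact R p m))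
                (≡.trans (≡.cong (map factor) (≡.sym (upTo-∷ʳ m))) (map-++ factor (upTo m) [ m ])) ⟩
    prodR R (map factor (upTo m) ++ [ factor m ]) * (qint R p (suc m) * qfact R p m)
      ≈⟨ *-congʳ (prodR-++ (map factor (upTo m)) [ factor m ]) ⟩
    (negPoch R x p m * (factor m * 1#)) * (qint R p (suc m) * qfact R p m)
      ≈⟨ solve 4 (λ A B Q F → (A :* (B :* con 1)) :* (Q :* F) := (A :* F) :* (B :* Q)) refl
           (negPoch R x p m) (factor m) (qint R p (suc m)) (qfact R p m) ⟩
    hatfact R x p m * ((1# + x * pow R p (suc m)) * qint R p (suc m)) ∎
    where
    factor : ℕ → Carrier
    factor i = 1# + x * pow R p (suc i)

  qint-sumAfter : ∀ p {m} (ns : Vec ℕ m) →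
    ∑ (upTo m) (λ v → pow R p (sumAfter ns v) * qint R p (lookupℕ ns v)) ≈ qint R p (sumℕ (toList ns))
  qint-sumAfter p []             = refl
  qint-sumAfter p {suc m} (y ∷ ms) = begin
    pow R p S * qint R p y + ∑ (applyUpTo suc m) _
      ≈⟨ +-congˡ (trans (∑-applyUpTo suc m _) (qint-sumAfter p ms)) ⟩
    pow R p S * qint R p y + qint R p S ≈⟨ +-comm _ _ ⟩
    qint R p S + pow R p S * qint R p y ≈⟨ sym (qint-+ p S y) ⟩
    qint R p (S +ℕ y)                   ≡⟨ ≡.cong (qint R p) (ℕ.+-comm S y) ⟩
    qint R p (y +ℕ S) ∎
    where
    S : ℕ
    S = sumℕ (toList ms)

  qint-sumBefore : ∀ p {m} (ns : Vec ℕ m) →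
    ∑ (upTo m) (λ v → pow R p (sumBefore ns v) * qint R p (lookupℕ ns v)) ≈ qint R p (sumℕ (toList ns))
  qint-sumBefore p []             = refl
  qint-sumBefore p {suc m} (y ∷ ms) = begin
    1# * qint R p y + ∑ (applyUpTo suc m) _
      ≈⟨ +-cong (*-identityˡ _) (∑-applyUpTo suc m _) ⟩
    qint R p y + ∑ (upTo m) (λ v → pow R p (y +ℕ sumBefore ms v) * qint R p (lookupℕ ms v))
      ≈⟨ +-congˡ (∑-cong (upTo m) (λ v → trans (*-congʳ (pow-+ p y (sumBefore ms v))) (*-assoc _ _ _))) ⟩
    qint R p y + ∑ (upTo m) (λ v → pow R p y * (pow R p (sumBefore ms v) * qint R p (lookupℕ ms v)))
      ≈⟨ +-congˡ (trans (sym (∑-*ˡ (upTo m) (pow R p y) _)) (*-congˡ (qint-sumBefore p ms))) ⟩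
    qint R p y + pow R p y * qint R p (sumℕ (toList ms)) ≈⟨ sym (qint-+ p y _) ⟩
    qint R p (y +ℕ sumℕ (toList ms)) ∎

  module Weights (k r′ : ℕ) (p a : Carrier) where

    x : Carrier
    x = xpar R (suc r′) a p

    E : List (ℕ × ℕ)
    E = entries k (suc r′)

    weight : ∀ {n} → Vec (ℕ × ℕ) n → Carrier
    weight f = pow R p (invF k f) * pow R a (colF k f)

    -- genSum with the membership test moved into the summand, so that f ranges over all of vecs n E
    weightSum : ℕ → Vec ℕ (suc k) → Carrier
    weightSum n comp = ∑ (vecs n E) (λ f → guard (inSet comp f) (weight f))

    stepWeight : ℕ → Vec ℕ (suc k) → ℕ → ℕ → Carrier
    stepWeight N comp v zero    = pow R p (sumAfter comp v)
    stepWeight N comp v (suc c) = pow R p (sumBefore comp v +ℕ (N +ℕ c)) * pow R a (suc c)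

    weight-∷ʳ : ∀ {n} (comp : Vec ℕ (suc k)) (f : Vec (ℕ × ℕ) n) {v} c → v < suc k →
                inSet (decrementAt comp v) f ≡ true → weight (f ∷ʳ (v , c)) ≈ weight f * stepWeight (suc n) comp v c
    weight-∷ʳ {n} comp f {v} zero v≤k ok = begin
      pow R p (invF k (f ∷ʳ (v , 0))) * pow R a (colF k (f ∷ʳ (v , 0)))
        ≡⟨ ≡.cong₂ (λ i j → pow R p i * pow R a j)
                   (≡.trans (invF-∷ʳ-top comp′ f counts v≤k) (≡.cong (invF k f +ℕ_) (sumAfter-decrementAt comp v)))
                   (colW-πf-∷ʳ f v≤k 0) ⟩
      pow R p (invF k f +ℕ sumAfter comp v) * pow R a (colF k f)
        ≈⟨ *-congʳ (pow-+ p (invF k f) (sumAfter comp v)) ⟩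
      (pow R p (invF k f) * pow R p (sumAfter comp v)) * pow R a (colF k f)
        ≈⟨ solve 3 (λ A B C → (A :* B) :* C := (A :* C) :* B) refl _ _ _ ⟩
      weight f * stepWeight (suc n) comp v 0 ∎
      where
      comp′ : Vec ℕ (suc k)
      comp′ = decrementAt comp v
      counts : HasCounts comp′ f
      counts = inSet⇒HasCounts comp′ f ok
    weight-∷ʳ {n} comp f {v} (suc c) v≤k ok = begin
      pow R p (invF k (f ∷ʳ (v , suc c))) * pow R a (colF k (f ∷ʳ (v , suc c)))
        ≡⟨ ≡.cong₂ (λ i j → pow R p i * pow R a j)
                   (≡.trans (invF-∷ʳ-bottom comp′ f counts v≤k c)
                            (≡.cong (λ l → invF k f +ℕ (l +ℕ (suc n +ℕ c))) (sumBefore-decrementAt comp v)))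
                   (colW-πf-∷ʳ f v≤k (suc c)) ⟩
      pow R p (invF k f +ℕ e) * pow R a (suc c +ℕ colF k f)
        ≈⟨ *-cong (pow-+ p (invF k f) e) (pow-+ a (suc c) (colF k f)) ⟩
      (pow R p (invF k f) * pow R p e) * (pow R a (suc c) * pow R a (colF k f))
        ≈⟨ solve 4 (λ A B C D → (A :* B) :* (C :* D) := (A :* D) :* (B :* C)) refl _ _ _ _ ⟩
      weight f * stepWeight (suc n) comp v (suc c) ∎
      where
      comp′ : Vec ℕ (suc k)
      comp′ = decrementAt comp v
      counts : HasCounts comp′ f
      counts = inSet⇒HasCounts comp′ f ok
      e : ℕ
      e = sumBefore comp v +ℕ (suc n +ℕ c)

    weight-summand : ∀ {n} (comp : Vec ℕ (suc k)) (f : Vec (ℕ × ℕ) n) {v} c → v < suc k →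
      guard (inSet comp (f ∷ʳ (v , c))) (weight (f ∷ʳ (v , c)))
        ≈ guard (colorOK (v , c) ∧ positive (lookupℕ comp v))
                (guard (inSet (decrementAt comp v) f) (weight f) * stepWeight (suc n) comp v c)
    weight-summand comp f {v} c v≤k rewrite inSet-∷ʳ comp f c v≤k
      with inSet (decrementAt comp v) f in ok | colorOK (v , c) ∧ positive (lookupℕ comp v)
    ... | true  | true  = weight-∷ʳ comp f c v≤k ok
    ... | true  | false = refl
    ... | false | true  = sym (zeroˡ _)
    ... | false | false = refl

    colourWeight : ℕ → Vec ℕ (suc k) → ℕ → Carrier
    colourWeight N comp zero    = pow R p (sumAfter comp 0)
    colourWeight N comp (suc v) = pow R p (sumAfter comp (suc v)) + pow R p (sumBefore comp (suc v) +ℕ N) * x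

    ∑-stepWeight : ∀ N comp v →
      ∑ (upTo (suc r′)) (λ c → guard (colorOK (v , c)) (stepWeight N comp v c)) ≈ colourWeight N comp v
    ∑-stepWeight N comp zero =
      trans (+-congˡ (trans (∑-applyUpTo suc r′ _) (∑-0 (upTo r′)))) (+-identityʳ _)
    ∑-stepWeight N comp (suc v) = +-congˡ (trans (∑-applyUpTo suc r′ _) (begin
      ∑ (upTo r′) (λ c → pow R p (B +ℕ (N +ℕ c)) * (a * pow R a c))
        ≈⟨ ∑-cong (upTo r′) term ⟩
      ∑ (upTo r′) (λ c → (pow R p (B +ℕ N) * a) * pow R (a * p) c)
        ≈⟨ sym (∑-*ˡ (upTo r′) _ (pow R (a * p))) ⟩
      (pow R p (B +ℕ N) * a) * qint R (a * p) r′
        ≈⟨ *-assoc _ _ _ ⟩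
      pow R p (B +ℕ N) * x ∎))
      where
      B : ℕ
      B = sumBefore comp (suc v)
      term : ∀ c → pow R p (B +ℕ (N +ℕ c)) * (a * pow R a c) ≈ (pow R p (B +ℕ N) * a) * pow R (a * p) c
      term c = begin
        pow R p (B +ℕ (N +ℕ c)) * (a * pow R a c)
          ≡⟨ ≡.cong (λ e → pow R p e * (a * pow R a c)) (≡.sym (ℕ.+-assoc B N c)) ⟩
        pow R p ((B +ℕ N) +ℕ c) * (a * pow R a c)
          ≈⟨ *-congʳ (pow-+ p (B +ℕ N) c) ⟩
        (pow R p (B +ℕ N) * pow R p c) * (a * pow R a c)
          ≈⟨ solve 4 (λ P Q a A → (P :* Q) :* (a :* A) := (P :* a) :* (A :* Q)) refl _ _ _ _ ⟩
        (pow R p (B +ℕ N) * a) * (pow R a c * pow R p c)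
          ≈⟨ *-congˡ (sym (pow-* a p c)) ⟩
        (pow R p (B +ℕ N) * a) * pow R (a * p) c ∎

    ∑-colours : ∀ N comp v X →
      ∑ (upTo (suc r′)) (λ c → guard (colorOK (v , c) ∧ positive (lookupℕ comp v)) (X * stepWeight N comp v c))
        ≈ guard (positive (lookupℕ comp v)) (X * colourWeight N comp v)
    ∑-colours N comp v X with positive (lookupℕ comp v)
    ... | false = trans (∑-cong (upTo (suc r′)) (λ c → guard-cong (X * stepWeight N comp v c) (∧-zeroʳ (colorOK (v , c)))))
                        (∑-0 (upTo (suc r′)))
    ... | true  = begin
      ∑ (upTo (suc r′)) (λ c → guard (colorOK (v , c) ∧ true) (X * stepWeight N comp v c))
        ≈⟨ ∑-cong (upTo (suc r′)) (λ c → trans (guard-cong (X * stepWeight N comp v c) (∧-identityʳ (colorOK (v , c))))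
                                               (guard-*ˡ (colorOK (v , c)) X _)) ⟩
      ∑ (upTo (suc r′)) (λ c → X * guard (colorOK (v , c)) (stepWeight N comp v c))
        ≈⟨ sym (∑-*ˡ (upTo (suc r′)) X _) ⟩
      X * ∑ (upTo (suc r′)) (λ c → guard (colorOK (v , c)) (stepWeight N comp v c))
        ≈⟨ *-congˡ (∑-stepWeight N comp v) ⟩
      X * colourWeight N comp v ∎

    weightSum-suc : ∀ n comp → weightSum (suc n) comp ≈
      ∑ (upTo (suc k)) (λ v → guard (positive (lookupℕ comp v)) (weightSum n (decrementAt comp v) * colourWeight (suc n) comp v))
    weightSum-suc n comp = begin
      weightSum (suc n) comp
        ≈⟨ ∑-vecs-∷ʳ n E g ⟩
      ∑ (vecs n E) (λ f → ∑ E (λ e → g (f ∷ʳ e)))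
        ≈⟨ ∑-swap (vecs n E) E (λ f e → g (f ∷ʳ e)) ⟩
      ∑ E (λ e → ∑ (vecs n E) (λ f → g (f ∷ʳ e)))
        ≈⟨ ∑-concatMap (upTo (suc k)) (λ v → map (v ,_) (upTo (suc r′))) _ ⟩
      ∑ (upTo (suc k)) (λ v → ∑ (map (v ,_) (upTo (suc r′))) (λ e → ∑ (vecs n E) (λ f → g (f ∷ʳ e))))
        ≈⟨ ∑-cong (upTo (suc k)) (λ v → ∑-map (upTo (suc r′)) (v ,_) _) ⟩
      ∑ (upTo (suc k)) (λ v → ∑ (upTo (suc r′)) (λ c → ∑ (vecs n E) (λ f → g (f ∷ʳ (v , c)))))
        ≈⟨ ∑-cong-upTo (suc k) value ⟩
      ∑ (upTo (suc k)) (λ v → guard (positive (lookupℕ comp v)) (weightSum n (decrementAt comp v) * colourWeight (suc n) comp v)) ∎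
      where
      g : Vec (ℕ × ℕ) (suc n) → Carrier
      g f = guard (inSet comp f) (weight f)
      value : ∀ v → v < suc k →
        ∑ (upTo (suc r′)) (λ c → ∑ (vecs n E) (λ f → g (f ∷ʳ (v , c))))
          ≈ guard (positive (lookupℕ comp v)) (weightSum n (decrementAt comp v) * colourWeight (suc n) comp v)
      value v v≤k = begin
        ∑ (upTo (suc r′)) (λ c → ∑ (vecs n E) (λ f → g (f ∷ʳ (v , c))))
          ≈⟨ ∑-cong (upTo (suc r′)) (λ c → ∑-cong (vecs n E) (λ f → weight-summand comp f c v≤k)) ⟩
        ∑ (upTo (suc r′)) (λ c → ∑ (vecs n E) (λ f →
            guard (colorOK (v , c) ∧ positive (lookupℕ comp v))
                  (guard (inSet (decrementAt comp v) f) (weight f) * stepWeight (suc n) comp v c)))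
          ≈⟨ ∑-cong (upTo (suc r′)) (λ c → ∑-guard-* (vecs n E) _ _ _) ⟩
        ∑ (upTo (suc r′)) (λ c → guard (colorOK (v , c) ∧ positive (lookupℕ comp v))
                                        (weightSum n (decrementAt comp v) * stepWeight (suc n) comp v c))
          ≈⟨ ∑-colours (suc n) comp v (weightSum n (decrementAt comp v)) ⟩
        guard (positive (lookupℕ comp v)) (weightSum n (decrementAt comp v) * colourWeight (suc n) comp v) ∎

    hat : ℕ → Carrier
    hat = hatfact R x p

    denominator : Vec ℕ (suc k) → Carrier
    denominator (n₀ ∷ ns) = hat n₀ * prodFactsTail R p ns

    denominatorStep : Vec ℕ (suc k) → ℕ → Carrier
    denominatorStep (n₀ ∷ ns) zero    = (1# + x * pow R p n₀) * qint R p n₀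
    denominatorStep (n₀ ∷ ns) (suc v) = qint R p (lookupℕ ns v)

    prodFactsTail-decrementAt : ∀ {m} (ns : Vec ℕ m) v → positive (lookupℕ ns v) ≡ true →
      prodFactsTail R p ns ≈ prodFactsTail R p (decrementAt ns v) * qint R p (lookupℕ ns v)
    prodFactsTail-decrementAt (suc y ∷ ms) zero    _   =
      solve 3 (λ Q F G → (Q :* F) :* G := (F :* G) :* Q) refl (qint R p (suc y)) (qfact R p y) (prodFactsTail R p ms)
    prodFactsTail-decrementAt (y ∷ ms)     (suc v) pos =
      trans (*-congˡ (prodFactsTail-decrementAt ms v pos)) (sym (*-assoc _ _ _))

    denominator-decrementAt : ∀ comp v → positive (lookupℕ comp v) ≡ true →
      denominator comp ≈ denominator (decrementAt comp v) * denominatorStep comp v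
    denominator-decrementAt (suc m ∷ ns) zero    _   = trans (*-congʳ (hatfact-suc x p m))
      (solve 3 (λ H G F → (H :* F) :* G := (H :* G) :* F) refl (hat m) (prodFactsTail R p ns) _)
    denominator-decrementAt (n₀ ∷ ns)    (suc v) pos =
      trans (*-congˡ (prodFactsTail-decrementAt ns v pos)) (sym (*-assoc _ _ _))

    denominatorStep-zero : ∀ comp v → positive (lookupℕ comp v) ≡ false → denominatorStep comp v ≈ 0#
    denominatorStep-zero (zero ∷ ns) zero    _ = zeroʳ _
    denominatorStep-zero (n₀ ∷ ns)   (suc v) _ with lookupℕ ns v
    ... | zero = refl

    ∑-colourWeight-tail : ∀ n₀ (ns : Vec ℕ k) N → let QS = qint R p (sumℕ (toList ns)) in
      ∑ (upTo k) (λ v → colourWeight N (n₀ ∷ ns) (suc v) * denominatorStep (n₀ ∷ ns) (suc v))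
        ≈ QS + (pow R p (n₀ +ℕ N) * x) * QS
    ∑-colourWeight-tail n₀ ns N = begin
      ∑ (upTo k) (λ v → colourWeight N (n₀ ∷ ns) (suc v) * denominatorStep (n₀ ∷ ns) (suc v))
        ≈⟨ trans (∑-cong (upTo k) expand) (∑-+ (upTo k) _ _) ⟩
      ∑ (upTo k) (λ v → pow R p (sumAfter ns v) * Q v) + ∑ (upTo k) (λ v → B * (pow R p (sumBefore ns v) * Q v))
        ≈⟨ +-cong (qint-sumAfter p ns) (trans (sym (∑-*ˡ (upTo k) B _)) (*-congˡ (qint-sumBefore p ns))) ⟩
      qint R p (sumℕ (toList ns)) + B * qint R p (sumℕ (toList ns)) ∎
      where
      B : Carrier
      B = pow R p (n₀ +ℕ N) * x
      Q : ℕ → Carrier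
      Q v = qint R p (lookupℕ ns v)
      expand : ∀ v → colourWeight N (n₀ ∷ ns) (suc v) * denominatorStep (n₀ ∷ ns) (suc v)
                    ≈ pow R p (sumAfter ns v) * Q v + B * (pow R p (sumBefore ns v) * Q v)
      expand v = begin
        (pow R p (sumAfter ns v) + pow R p ((n₀ +ℕ sumBefore ns v) +ℕ N) * x) * Q v
          ≡⟨ ≡.cong (λ e → (pow R p (sumAfter ns v) + pow R p e * x) * Q v) (xy∙z≈xz∙y n₀ (sumBefore ns v) N) ⟩
        (pow R p (sumAfter ns v) + pow R p ((n₀ +ℕ N) +ℕ sumBefore ns v) * x) * Q v
          ≈⟨ *-congʳ (+-congˡ (*-congʳ (pow-+ p (n₀ +ℕ N) (sumBefore ns v)))) ⟩
        (pow R p (sumAfter ns v) + (pow R p (n₀ +ℕ N) * pow R p (sumBefore ns v)) * x) * Q v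
          ≈⟨ solve 5 (λ A B C x Q → (A :+ (B :* C) :* x) :* Q := A :* Q :+ (B :* x) :* (C :* Q)) refl _ _ _ _ _ ⟩
        pow R p (sumAfter ns v) * Q v + B * (pow R p (sumBefore ns v) * Q v) ∎

    ∑-colourWeight : ∀ n₀ (ns : Vec ℕ k) {N} → n₀ +ℕ sumℕ (toList ns) ≡ N →
      ∑ (upTo (suc k)) (λ v → colourWeight N (n₀ ∷ ns) v * denominatorStep (n₀ ∷ ns) v) ≈ (1# + x * pow R p N) * qint R p N
    ∑-colourWeight n₀ ns ≡.refl = begin
      PS * ((1# + x * P0) * Q0) + ∑ (applyUpTo suc k) _
        ≈⟨ +-congˡ (trans (∑-applyUpTo suc k _) (∑-colourWeight-tail n₀ ns N)) ⟩
      PS * ((1# + x * P0) * Q0) + (QS + (pow R p (n₀ +ℕ N) * x) * QS)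
        ≈⟨ +-congˡ (+-congˡ (*-congʳ (*-congʳ (trans (pow-+ p n₀ N) (*-congˡ (pow-+ p n₀ S)))))) ⟩
      PS * ((1# + x * P0) * Q0) + (QS + ((P0 * (P0 * PS)) * x) * QS)
        ≈⟨ solve 5 (λ PS P0 Q0 QS x → PS :* ((con 1 :+ x :* P0) :* Q0) :+ (QS :+ ((P0 :* (P0 :* PS)) :* x) :* QS)
                                    := (QS :+ PS :* Q0) :+ (x :* (P0 :* PS)) :* (Q0 :+ P0 :* QS)) refl PS P0 Q0 QS x ⟩
      (QS + PS * Q0) + (x * (P0 * PS)) * (Q0 + P0 * QS)
        ≈⟨ +-cong (sym (trans (reflexive (≡.cong (qint R p) (ℕ.+-comm n₀ S))) (qint-+ p S n₀)))
                  (*-cong (*-congˡ (sym (pow-+ p n₀ S))) (sym (qint-+ p n₀ S))) ⟩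
      QN + (x * PN) * QN
        ≈⟨ solve 3 (λ QN x PN → QN :+ (x :* PN) :* QN := (con 1 :+ x :* PN) :* QN) refl QN x PN ⟩
      (1# + x * PN) * QN ∎
      where
      S N : ℕ
      S = sumℕ (toList ns)
      N = n₀ +ℕ S
      PS P0 PN Q0 QS QN : Carrier
      PS = pow R p S
      P0 = pow R p n₀
      PN = pow R p N
      Q0 = qint R p n₀
      QS = qint R p S
      QN = qint R p N

    weightSum-zero : ∀ comp → sumℕ (toList comp) ≡ 0 → weightSum 0 comp ≈ 1#
    weightSum-zero comp sum≡0 rewrite inSet-empty comp sum≡0 | πf-empty (suc k) =
      trans (+-identityʳ _) (*-identityˡ 1#)

    denominator-empty : ∀ comp → sumℕ (toList comp) ≡ 0 → denominator comp ≈ 1#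
    denominator-empty (zero ∷ ns) sum≡0 =
      trans (*-cong (*-identityˡ 1#) (prodFactsTail-empty ns sum≡0)) (*-identityˡ 1#)
      where
      prodFactsTail-empty : ∀ {m} (ns : Vec ℕ m) → sumℕ (toList ns) ≡ 0 → prodFactsTail R p ns ≈ 1#
      prodFactsTail-empty []          _     = refl
      prodFactsTail-empty (zero ∷ ns) sum≡0 = trans (*-identityˡ _) (prodFactsTail-empty ns sum≡0)

    weightSum*denominator : ∀ n comp → sumℕ (toList comp) ≡ n → weightSum n comp * denominator comp ≈ hat n
    weightSum*denominator zero    comp sum≡0 =
      trans (*-cong (weightSum-zero comp sum≡0) (denominator-empty comp sum≡0))
            (trans (*-identityˡ 1#) (sym (*-identityˡ 1#)))
    weightSum*denominator (suc n) comp@(n₀ ∷ ns) sum≡ = begin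
      weightSum (suc n) comp * denominator comp
        ≈⟨ trans (*-congʳ (weightSum-suc n comp)) (∑-*ʳ (upTo (suc k)) _ _) ⟩
      ∑ (upTo (suc k)) (λ v → guard (positive (lookupℕ comp v)) (weightSum n (decrementAt comp v) * W v) * denominator comp)
        ≈⟨ ∑-cong (upTo (suc k)) term ⟩
      ∑ (upTo (suc k)) (λ v → (W v * denominatorStep comp v) * hat n)
        ≈⟨ sym (∑-*ʳ (upTo (suc k)) _ _) ⟩
      ∑ (upTo (suc k)) (λ v → W v * denominatorStep comp v) * hat n
        ≈⟨ *-congʳ (∑-colourWeight n₀ ns sum≡) ⟩
      ((1# + x * pow R p (suc n)) * qint R p (suc n)) * hat n
        ≈⟨ trans (*-comm _ _) (sym (hatfact-suc x p n)) ⟩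
      hat (suc n) ∎
      where
      W : ℕ → Carrier
      W = colourWeight (suc n) comp
      term : ∀ v → guard (positive (lookupℕ comp v)) (weightSum n (decrementAt comp v) * W v) * denominator comp
                 ≈ (W v * denominatorStep comp v) * hat n
      term v with positive (lookupℕ comp v) in pos
      ... | false =
        trans (zeroˡ _) (sym (trans (*-congʳ (trans (*-congˡ (denominatorStep-zero comp v pos)) (zeroʳ _))) (zeroˡ _)))
      ... | true  = begin
        (weightSum n comp′ * W v) * denominator comp
          ≈⟨ *-congˡ (denominator-decrementAt comp v pos) ⟩
        (weightSum n comp′ * W v) * (denominator comp′ * denominatorStep comp v)
          ≈⟨ solve 4 (λ A B C F → (A :* B) :* (C :* F) := (B :* F) :* (A :* C)) refl _ _ _ _ ⟩
        (W v * denominatorStep comp v) * (weightSum n comp′ * denominator comp′)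
          ≈⟨ *-congˡ (weightSum*denominator n comp′ sum′≡n) ⟩
        (W v * denominatorStep comp v) * hat n ∎
        where
        comp′ : Vec ℕ (suc k)
        comp′ = decrementAt comp v
        sum′≡n : sumℕ (toList comp′) ≡ n
        sum′≡n = ℕ.suc-injective (≡.trans (≡.sym (sumℕ-decrementAt comp v pos)) sum≡)

lemma4p3 : {c ℓ : Level} (R : CommutativeSemiring c ℓ) →
    (r n k : ℕ) → 1 ≤ r →
    (n₀ : ℕ) (ns : Vec ℕ k) → sumℕ (toList (n₀ ∷ ns)) ≡ n →
    (p a : CommutativeSemiring.Carrier R) →
    CommutativeSemiring._≈_ R
      (CommutativeSemiring._*_ R
        (genSum R r n k (n₀ ∷ ns) p a)
        (CommutativeSemiring._*_ R
          (hatfact R (xpar R r a p) p n₀)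
          (prodFactsTail R p ns)))
      (hatfact R (xpar R r a p) p n)
lemma4p3 R (suc r′) n k _ n₀ ns sum≡n p a =
  trans (*-congʳ (∑-filterᵇ (vecs n E) (inSet (n₀ ∷ ns)) weight)) (weightSum*denominator n (n₀ ∷ ns) sum≡n)
  where
  open CommutativeSemiring R
  open Semiring R
  open Weights k r′ p a
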